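{- Let $X$ be a family of sets closed under finite intersections and $Y$ a family of sets closed under finite unions with least element $\overline0$. Let $\theta:X\to Y$ be a bijection such that: - for all $A,B,C\in X$: $A\cap\theta^{ -1}(\theta(B)\cup\theta(C))=\theta^{ -1}(\theta(A\cap B)\cup\theta(A\cap C))$; - for all $P,Q,R\in Y$: $P\cup\theta(\theta^{ -1}(Q)\cap\theta^{ -1}(R))=\theta(\theta^{ -1}(P\cup Q)\cap\theta^{ -1}(P\cup R))$. Let ${}^\star:Y\to X$ be an inclusion-reversing order isomorphism with ${}^\star\circ\theta=\theta^{ -1}\circ({}^\star)^{ -1}$. Assume moreover that, for all $A,B\in X$, $\theta(A\cap(\theta(A))^\star)\subseteq\theta(A\cap B)$. For $A,B\in X$ define $A+B=\theta^{ -1}(\theta(A)\cup\theta(B))$, $A\cdot B=A\cap B$, $A^\dagger=(\theta(A))^\star$, $\bot=\theta^{ -1}(\overline0)$ and $\top=\overline0^\star$. Then $\langle X,\cdot,+,{}^\dagger,\bot,\top\rangle$ is an involutive bisemilattice.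
   Context: An involutive bisemilattice is an algebra $\langle A,\land,\lor,',0,1\rangle$ satisfying: (I1) $x\lor x=x$; (I2) $x\lor y=y\lor x$; (I3) $x\lor(y\lor z)=(x\lor y)\lor z$; (I4) $x''=x$; (I5) $x\land y=(x'\lor y')'$; (I6) $x\land(x'\lor y)=x\land y$; (I7) $0\lor x=x$; (I8) $0=1'$. -}

module Defs where

open import Level using (0ℓ; suc)
open import Data.Product using (Σ; _×_; _,_; proj₁; proj₂)
open import Relation.Unary using (Pred; _∈_; _∩_; _∪_; _⊆_; _≐_)
open import Relation.Unary.Properties using (≐-refl; ≐-sym; ≐-trans)
open import Relation.Binary.Bundles using (Setoid)
open import Relation.Binary.Structures using (IsEquivalence)
open import Function.Bundles using (Inverse)

-- Sets over a universe U are predicates on U; two sets are equal when they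
-- have the same elements (extensional equality _≐_).
SetOf : Set → Set₁
SetOf U = Pred U 0ℓ

Family : Set → Set₁
Family U = Pred (SetOf U) 0ℓ

Mem : {U : Set} → Family U → Set₁
Mem {U} F = Σ (SetOf U) (λ A → A ∈ F)

_≈ₘ_ : {U : Set} {F : Family U} → Mem F → Mem F → Set
A ≈ₘ B = proj₁ A ≐ proj₁ B

_⊆ₘ_ : {U : Set} {F : Family U} → Mem F → Mem F → Set
A ⊆ₘ B = proj₁ A ⊆ proj₁ B

MemSetoid : {U : Set} → Family U → Setoid (suc 0ℓ) 0ℓ
MemSetoid F = record
  { Carrier = Mem F
  ; _≈_ = _≈ₘ_
  ; isEquivalence = record { refl = ≐-refl ; sym = ≐-sym ; trans = ≐-trans }
  }

record IsInvolutiveBisemilattice {a ℓ} {A : Set a} (_≈_ : A → A → Set ℓ)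
    (_∧_ _∨_ : A → A → A) (_′ : A → A) (𝟘 𝟙 : A) : Set (a Level.⊔ ℓ) where
  field
    isEquivalence : IsEquivalence _≈_
    ∨-cong : ∀ {x y u v} → x ≈ y → u ≈ v → (x ∨ u) ≈ (y ∨ v)
    ∧-cong : ∀ {x y u v} → x ≈ y → u ≈ v → (x ∧ u) ≈ (y ∧ v)
    ′-cong : ∀ {x y} → x ≈ y → (x ′) ≈ (y ′)
    I1 : ∀ x → (x ∨ x) ≈ x
    I2 : ∀ x y → (x ∨ y) ≈ (y ∨ x)
    I3 : ∀ x y z → (x ∨ (y ∨ z)) ≈ ((x ∨ y) ∨ z)
    I4 : ∀ x → ((x ′) ′) ≈ x
    I5 : ∀ x y → (x ∧ y) ≈ (((x ′) ∨ (y ′)) ′)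
    I6 : ∀ x y → (x ∧ ((x ′) ∨ y)) ≈ (x ∧ y)
    I7 : ∀ x → (𝟘 ∨ x) ≈ x
    I8 : 𝟘 ≈ (𝟙 ′)

record Setting (U : Set) : Set₂ where
  field
    X : Family U
    Y : Family U
    X-∩ : ∀ {A B} → A ∈ X → B ∈ X → (A ∩ B) ∈ X
    Y-∪ : ∀ {P Q} → P ∈ Y → Q ∈ Y → (P ∪ Q) ∈ Y
    0̄ : SetOf U
    0̄∈Y : 0̄ ∈ Y
    0̄-least : ∀ {P} → P ∈ Y → 0̄ ⊆ P
    θ-bij : Inverse (MemSetoid X) (MemSetoid Y)

  θ : Mem X → Mem Y
  θ = Inverse.to θ-bij
  θ⁻¹ : Mem Y → Mem X
  θ⁻¹ = Inverse.from θ-bij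

  _∩X_ : Mem X → Mem X → Mem X
  (A , a) ∩X (B , b) = (A ∩ B) , X-∩ a b

  _∪Y_ : Mem Y → Mem Y → Mem Y
  (P , p) ∪Y (Q , q) = (P ∪ Q) , Y-∪ p q

  0̄ₘ : Mem Y
  0̄ₘ = 0̄ , 0̄∈Y

  field
    θ-dist₁ : ∀ (A B C : Mem X) →
      (A ∩X θ⁻¹ (θ B ∪Y θ C)) ≈ₘ θ⁻¹ (θ (A ∩X B) ∪Y θ (A ∩X C))
    θ-dist₂ : ∀ (P Q R : Mem Y) →
      (P ∪Y θ (θ⁻¹ Q ∩X θ⁻¹ R)) ≈ₘ θ (θ⁻¹ (P ∪Y Q) ∩X θ⁻¹ (P ∪Y R))
    ⋆-bij : Inverse (MemSetoid Y) (MemSetoid X)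

  _⋆ : Mem Y → Mem X
  _⋆ = Inverse.to ⋆-bij
  ⋆⁻¹ : Mem X → Mem Y
  ⋆⁻¹ = Inverse.from ⋆-bij

  field
    ⋆-antitone : ∀ (P Q : Mem Y) → P ⊆ₘ Q → (Q ⋆) ⊆ₘ (P ⋆)
    ⋆-antitone⁻ : ∀ (P Q : Mem Y) → (Q ⋆) ⊆ₘ (P ⋆) → P ⊆ₘ Q
    ⋆θ : ∀ (A : Mem X) → (θ A ⋆) ≈ₘ θ⁻¹ (⋆⁻¹ A)
    θ-bot : ∀ (A B : Mem X) → θ (A ∩X (θ A ⋆)) ⊆ₘ θ (A ∩X B)

  _+_ : Mem X → Mem X → Mem X
  A + B = θ⁻¹ (θ A ∪Y θ B)

  _·_ : Mem X → Mem X → Mem X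
  A · B = A ∩X B

  _† : Mem X → Mem X
  A † = θ A ⋆

  ⊥X : Mem X
  ⊥X = θ⁻¹ 0̄ₘ

  ⊤X : Mem X
  ⊤X = 0̄ₘ ⋆

module Submission where

-- Transport along the bijection θ turns + into ∪ on Y, so the
-- join axioms I1–I3 and I7 are the semilattice laws of ∪ (with 0̄ least).
-- The hypothesis ⋆ ∘ θ = θ⁻¹ ∘ ⋆⁻¹ says  A† = θ⁻¹(⋆⁻¹ A), i.e. † is the
-- composite of two bijections whose composite with itself is the identity
-- (I4), and which gives  θ(A†) = ⋆⁻¹ A.  An order-reversing isomorphism
-- sends unions to intersections, so  (A† + B†)† = (⋆⁻¹A ∪ ⋆⁻¹B)⋆ = A ∩ B
-- (I5).  Finally I6 is the first distributivity hypothesis followed by the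
-- absorption  θ(A ∩ A†) ⊆ θ(A ∩ B).

open import Defs
open import Data.Product using (_,_; proj₁; proj₂)
open import Data.Sum using (inj₁; inj₂; [_,_]′)
open import Function.Base using (id)
open import Function.Bundles using (Inverse)
open import Relation.Unary using (_∈_; _∩_; _∪_; _⊆_; _≐_)
open import Relation.Unary.Properties using (≐-refl; ≐-sym; ≐-trans)
open import Relation.Unary.Algebra using (∪-cong; ∪-comm; ∪-assoc; ∪-idem; ∩-cong)
import Relation.Binary.Reasoning.Setoid as SetoidReasoning

∪-absorbˡ : {U : Set} {P Q : SetOf U} → P ⊆ Q → (P ∪ Q) ≐ Q
∪-absorbˡ P⊆Q = [ P⊆Q , id ]′ , inj₂

-- An order-reversing isomorphism f between a ∪-closed family Y and a
-- ∩-closed family X (reflecting the order as well) turns unions into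
-- intersections: f(P ∪ Q) is the largest member of X below f P and f Q.
antitone-iso-∪ : {U : Set} {X Y : Family U}
  (Y-∪ : ∀ {P Q} → P ∈ Y → Q ∈ Y → (P ∪ Q) ∈ Y)
  (X-∩ : ∀ {A B} → A ∈ X → B ∈ X → (A ∩ B) ∈ X)
  (f : Inverse (MemSetoid Y) (MemSetoid X)) →
  (∀ (P Q : Mem Y) → P ⊆ₘ Q → Inverse.to f Q ⊆ₘ Inverse.to f P) →
  (∀ (P Q : Mem Y) → Inverse.to f Q ⊆ₘ Inverse.to f P → P ⊆ₘ Q) →
  ∀ (P Q : Mem Y) →
  proj₁ (Inverse.to f ((proj₁ P ∪ proj₁ Q) , Y-∪ (proj₂ P) (proj₂ Q)))
    ≐ (proj₁ (Inverse.to f P) ∩ proj₁ (Inverse.to f Q))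
antitone-iso-∪ {X = X} {Y} Y-∪ X-∩ f antitone reflects P Q =
  (λ x → antitone P P∪Q inj₁ x , antitone Q P∪Q inj₂ x) , below-meet
  where
  open Inverse f using (to; from)
  P∪Q : Mem Y
  P∪Q = (proj₁ P ∪ proj₁ Q) , Y-∪ (proj₂ P) (proj₂ Q)
  -- the preimage R of  f P ∩ f Q  lies above P and Q, hence above P ∪ Q
  meet : Mem X
  meet = (proj₁ (to P) ∩ proj₁ (to Q)) , X-∩ (proj₂ (to P)) (proj₂ (to Q))
  R : Mem Y
  R = from meet
  fR≐meet : proj₁ (to R) ≐ proj₁ meet
  fR≐meet = Inverse.strictlyInverseˡ f meet
  P∪Q⊆R : P∪Q ⊆ₘ R
  P∪Q⊆R = [ reflects P R (λ x → proj₁ (proj₁ fR≐meet x))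
          , reflects Q R (λ x → proj₂ (proj₁ fR≐meet x)) ]′
  below-meet : proj₁ meet ⊆ proj₁ (to P∪Q)
  below-meet x = antitone P∪Q R P∪Q⊆R (proj₂ fR≐meet x)

module Lemma4p3 {U : Set} (S : Setting U) where
  open Setting S

  θ-cong : ∀ {A B} → A ≈ₘ B → θ A ≈ₘ θ B
  θ-cong = Inverse.to-cong θ-bij

  θ⁻¹-cong : ∀ {P Q} → P ≈ₘ Q → θ⁻¹ P ≈ₘ θ⁻¹ Q
  θ⁻¹-cong = Inverse.from-cong θ-bij

  ⋆-cong : ∀ {P Q} → P ≈ₘ Q → (P ⋆) ≈ₘ (Q ⋆)
  ⋆-cong = Inverse.to-cong ⋆-bij

  θ∘θ⁻¹ : ∀ P → θ (θ⁻¹ P) ≈ₘ P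
  θ∘θ⁻¹ = Inverse.strictlyInverseˡ θ-bij

  θ⁻¹∘θ : ∀ A → θ⁻¹ (θ A) ≈ₘ A
  θ⁻¹∘θ = Inverse.strictlyInverseʳ θ-bij

  ⋆∘⋆⁻¹ : ∀ A → (⋆⁻¹ A ⋆) ≈ₘ A
  ⋆∘⋆⁻¹ = Inverse.strictlyInverseˡ ⋆-bij

  ⋆⁻¹∘⋆ : ∀ P → ⋆⁻¹ (P ⋆) ≈ₘ P
  ⋆⁻¹∘⋆ = Inverse.strictlyInverseʳ ⋆-bij

  θ-+ : ∀ A B → θ (A + B) ≈ₘ (θ A ∪Y θ B)
  θ-+ A B = θ∘θ⁻¹ (θ A ∪Y θ B)

  ⋆-∪ : ∀ P Q → ((P ∪Y Q) ⋆) ≈ₘ ((P ⋆) ∩X (Q ⋆))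
  ⋆-∪ = antitone-iso-∪ Y-∪ X-∩ ⋆-bij ⋆-antitone ⋆-antitone⁻

  θ-† : ∀ A → θ (A †) ≈ₘ ⋆⁻¹ A
  θ-† A = ≐-trans (θ-cong (⋆θ A)) (θ∘θ⁻¹ (⋆⁻¹ A))

  +-idem : ∀ A → (A + A) ≈ₘ A
  +-idem A = begin
    θ⁻¹ (θ A ∪Y θ A)  ≈⟨ θ⁻¹-cong (∪-idem (proj₁ (θ A))) ⟩
    θ⁻¹ (θ A)         ≈⟨ θ⁻¹∘θ A ⟩
    A                 ∎
    where open SetoidReasoning (MemSetoid X)

  +-assoc : ∀ A B C → (A + (B + C)) ≈ₘ ((A + B) + C)
  +-assoc A B C = θ⁻¹-cong (begin
    θ A ∪Y θ (B + C)         ≈⟨ ∪-cong ≐-refl (θ-+ B C) ⟩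
    θ A ∪Y (θ B ∪Y θ C)      ≈⟨ ∪-assoc (proj₁ (θ A)) (proj₁ (θ B)) (proj₁ (θ C)) ⟨
    (θ A ∪Y θ B) ∪Y θ C      ≈⟨ ∪-cong (θ-+ A B) ≐-refl ⟨
    θ (A + B) ∪Y θ C         ∎)
    where open SetoidReasoning (MemSetoid Y)

  ††-involutive : ∀ A → ((A †) †) ≈ₘ A
  ††-involutive A = begin
    (A †) †              ≈⟨ ⋆θ (A †) ⟩
    θ⁻¹ (⋆⁻¹ (θ A ⋆))    ≈⟨ θ⁻¹-cong (⋆⁻¹∘⋆ (θ A)) ⟩
    θ⁻¹ (θ A)            ≈⟨ θ⁻¹∘θ A ⟩
    A                    ∎
    where open SetoidReasoning (MemSetoid X)

  ·-de-Morgan : ∀ A B → (A · B) ≈ₘ (((A †) + (B †)) †)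
  ·-de-Morgan A B = begin
    A ∩X B                           ≈⟨ ∩-cong (⋆∘⋆⁻¹ A) (⋆∘⋆⁻¹ B) ⟨
    (⋆⁻¹ A ⋆) ∩X (⋆⁻¹ B ⋆)           ≈⟨ ⋆-∪ (⋆⁻¹ A) (⋆⁻¹ B) ⟨
    (⋆⁻¹ A ∪Y ⋆⁻¹ B) ⋆               ≈⟨ ⋆-cong (∪-cong (θ-† A) (θ-† B)) ⟨
    (θ (A †) ∪Y θ (B †)) ⋆           ≈⟨ ⋆-cong (θ-+ (A †) (B †)) ⟨
    θ ((A †) + (B †)) ⋆              ∎
    where open SetoidReasoning (MemSetoid X)

  ·-absorbs-† : ∀ A B → (A · ((A †) + B)) ≈ₘ (A · B)
  ·-absorbs-† A B = begin
    A ∩X θ⁻¹ (θ (A †) ∪Y θ B)                ≈⟨ θ-dist₁ A (A †) B ⟩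
    θ⁻¹ (θ (A ∩X (A †)) ∪Y θ (A ∩X B))       ≈⟨ θ⁻¹-cong (∪-absorbˡ (θ-bot A B)) ⟩
    θ⁻¹ (θ (A ∩X B))                         ≈⟨ θ⁻¹∘θ (A ∩X B) ⟩
    A ∩X B                                   ∎
    where open SetoidReasoning (MemSetoid X)

  ⊥-identityˡ : ∀ A → (⊥X + A) ≈ₘ A
  ⊥-identityˡ A = begin
    θ⁻¹ (θ (θ⁻¹ 0̄ₘ) ∪Y θ A)   ≈⟨ θ⁻¹-cong (∪-cong (θ∘θ⁻¹ 0̄ₘ) ≐-refl) ⟩
    θ⁻¹ (0̄ₘ ∪Y θ A)           ≈⟨ θ⁻¹-cong (∪-absorbˡ (0̄-least (proj₂ (θ A)))) ⟩
    θ⁻¹ (θ A)                 ≈⟨ θ⁻¹∘θ A ⟩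
    A                         ∎
    where open SetoidReasoning (MemSetoid X)

  ⊥≈⊤† : ⊥X ≈ₘ (⊤X †)
  ⊥≈⊤† = begin
    θ⁻¹ 0̄ₘ              ≈⟨ θ⁻¹-cong (⋆⁻¹∘⋆ 0̄ₘ) ⟨
    θ⁻¹ (⋆⁻¹ (0̄ₘ ⋆))    ≈⟨ ⋆θ ⊤X ⟨
    ⊤X †                ∎
    where open SetoidReasoning (MemSetoid X)

lemma4p3 : (U : Set) (S : Setting U) →
    let open Setting S in
    IsInvolutiveBisemilattice (_≈ₘ_ {U} {X}) _·_ _+_ _† ⊥X ⊤X
lemma4p3 U S = record
  { isEquivalence = record { refl = ≐-refl ; sym = ≐-sym ; trans = ≐-trans }
  ; ∨-cong = λ A≈B C≈D → θ⁻¹-cong (∪-cong (θ-cong A≈B) (θ-cong C≈D))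
  ; ∧-cong = ∩-cong
  ; ′-cong = λ A≈B → ⋆-cong (θ-cong A≈B)
  ; I1 = +-idem
  ; I2 = λ A B → θ⁻¹-cong (∪-comm (proj₁ (θ A)) (proj₁ (θ B)))
  ; I3 = +-assoc
  ; I4 = ††-involutive
  ; I5 = ·-de-Morgan
  ; I6 = ·-absorbs-†
  ; I7 = ⊥-identityˡ
  ; I8 = ⊥≈⊤†
  }
  where
  open Setting S
  open Lemma4p3 S
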